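{- Work constructively (intuitionistic logic with countable choice) and assume $\neg$LPO. If $(f_n)_{n \geq 1}$ is a sequence of functions $f_n : \mathbb{N}_\infty \to \{0,1\}$ such that $f_n(x) \to 0$ for every $x \in \mathbb{N}_\infty$, then $f_n \to 0$ uniformly on $\mathbb{N}_\infty$, i.e. there exists $N$ such that $f_i(\alpha) = 0$ for all $i \geq N$ and all $\alpha \in \mathbb{N}_\infty$.
   Context: $\mathbb{N}_\infty$ is the set of all increasing binary sequences with the metric inherited from Cantor space. $f_n(x) \to 0$ means $f_n(x) = 0$ for all sufficiently large $n$. LPO: for every binary sequence $(a_n)$, either $a_n = 0$ for all $n$ or there exists $n$ with $a_n = 1$. -}

module Defs where

open import Data.Bool using (Bool; true; false)
open import Data.Bool.Base as B using ()
open import Data.Nat using (ℕ; suc; _≥_)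
open import Data.Product using (Σ; ∃; _,_; proj₁)
open import Data.Sum using (_⊎_)
open import Relation.Nullary using (¬_)
open import Relation.Binary.PropositionalEquality using (_≡_)

LPO : Set
LPO = (a : ℕ → Bool) → (∀ n → a n ≡ false) ⊎ (∃ λ n → a n ≡ true)

Increasing : (ℕ → Bool) → Set
Increasing α = ∀ n → α n B.≤ α (suc n)

ℕ∞ : Set
ℕ∞ = Σ (ℕ → Bool) Increasing

_≈∞_ : ℕ∞ → ℕ∞ → Set
x ≈∞ y = ∀ n → proj₁ x n ≡ proj₁ y n

RespectsEq : (ℕ∞ → Bool) → Set
RespectsEq g = ∀ x y → x ≈∞ y → g x ≡ g y

-- "f_n(x) → 0": f_n(x) = 0 for all sufficiently large n  (0 = false).
EventuallyZero : (ℕ → Bool) → Set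
EventuallyZero s = ∃ λ N → ∀ n → n ≥ N → s n ≡ false

-- ℕ∞ is searchable (Escardó), so for every n we can decide whether fₙ vanishes
-- identically, and otherwise pick a point pₙ with fₙ(pₙ) = 1; let hits n = fₙ(pₙ).
-- For a binary sequence s that can only be 1 where hits is, glue the point
-- "p_m for the least m with s m = 1" (∞ if there is none); since f(·)(x) → 0 at
-- that point x, the least m lies below a computable bound, so s satisfies LPO.
-- If hits were 1 infinitely often, every binary sequence could be tested along
-- its 1s, which is LPO; the omniscience of "m is the last 1 of hits" turns ¬LPO
-- into an explicit N beyond which hits, and hence every fᵢ, vanishes.
module Submission where

open import Defs
open import Data.Bool using (Bool; true; false; not; _∧_; _∨_)
open import Data.Bool.Base as B using (b≤b; f≤t)
open import Data.Bool.Properties using (¬-not; ∧-conicalˡ; ∧-conicalʳ; ∨-zeroʳ; T-≡; ≤-minimum) renaming (_≟_ to _B≟_)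
open import Data.Nat using (ℕ; zero; suc; _≤_; _<_; _≥_; _≰_; _⊔_; _≤ᵇ_; z≤n; s≤s; _≤′_; ≤′-refl; ≤′-step)
open import Data.Nat.Properties
  using (≤-refl; ≤-trans; ≤-antisym; ≤-pred; m≤n⇒m≤1+n; m≤n⇒m<n∨m≡n; ≰⇒>; <⇒≱; <-≤-trans; n≮0;
         m≤m⊔n; m≤n⊔m; _≤?_; ≤ᵇ⇒≤; ≤⇒≤ᵇ; ≤⇒≤′; anyUpTo?)
open import Data.Product using (∃; _,_; proj₁; proj₂; _×_)
open import Data.Sum using (_⊎_; inj₁; inj₂)
open import Function using (_∘_; const)
open import Function.Bundles using (module Equivalence)
open import Relation.Nullary using (¬_; Dec; yes; no; does; contradiction)
open import Relation.Nullary.Decidable using (map′; dec-true; dec-false)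
open import Relation.Binary.PropositionalEquality using (_≡_; _≢_; refl; sym; trans; cong; cong₂; module ≡-Reasoning)

≢true⇒≡false : ∀ {b} → b ≢ true → b ≡ false
≢true⇒≡false = ¬-not

≡true⇒≢false : ∀ {b} → b ≡ true → b ≢ false
≡true⇒≢false refl ()

≤⇒≤ᵇ≡true : ∀ {m n} → m ≤ n → (m ≤ᵇ n) ≡ true
≤⇒≤ᵇ≡true = Equivalence.to T-≡ ∘ ≤⇒≤ᵇ

≤ᵇ≡true⇒≤ : ∀ m n → (m ≤ᵇ n) ≡ true → m ≤ n
≤ᵇ≡true⇒≤ m n = ≤ᵇ⇒≤ m n ∘ Equivalence.from T-≡

≰⇒≤ᵇ≡false : ∀ {m n} → m ≰ n → (m ≤ᵇ n) ≡ false
≰⇒≤ᵇ≡false {m} {n} m≰n = ≢true⇒≡false (m≰n ∘ ≤ᵇ≡true⇒≤ m n)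

≤-from-⇒ : ∀ {b c} → (b ≡ true → c ≡ true) → b B.≤ c
≤-from-⇒ {false} _ = ≤-minimum _
≤-from-⇒ {true} b⇒c with refl ← b⇒c refl = b≤b

≤-true : ∀ {b c} → b B.≤ c → b ≡ true → c ≡ true
≤-true b≤b b≡true = b≡true
≤-true f≤t _ = refl

≤⇒∨≡ : ∀ {b c} → b B.≤ c → b ∨ c ≡ c
≤⇒∨≡ f≤t = refl
≤⇒∨≡ {false} b≤b = refl
≤⇒∨≡ {true} b≤b = refl

fin : ℕ → ℕ∞
fin j = (j ≤ᵇ_) , λ t → ≤-from-⇒ (≤⇒≤ᵇ≡true ∘ m≤n⇒m≤1+n ∘ ≤ᵇ≡true⇒≤ j t)

∞ : ℕ∞
∞ = const false , λ _ → b≤b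

true-upward : (α : ℕ∞) {m n : ℕ} → proj₁ α m ≡ true → m ≤ n → proj₁ α n ≡ true
true-upward α αm = go ∘ ≤⇒≤′
  where
  go : ∀ {n} → _ ≤′ n → proj₁ α n ≡ true
  go ≤′-refl = αm
  go (≤′-step m≤′n) = ≤-true (proj₂ α _) (go m≤′n)

false-downward : (α : ℕ∞) {m n : ℕ} → proj₁ α n ≡ false → m ≤ n → proj₁ α m ≡ false
false-downward α αn m≤n = ≢true⇒≡false λ αm → ≡true⇒≢false (true-upward α αm m≤n) αn

LeastTrue : (ℕ → Bool) → ℕ → Set
LeastTrue s m = s m ≡ true × (∀ i → i < m → s i ≡ false)

least⇒≈fin : (α : ℕ∞) {j : ℕ} → LeastTrue (proj₁ α) j → α ≈∞ fin j
least⇒≈fin α {j} (αj , below) n with j ≤? n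
... | yes j≤n = trans (true-upward α αj j≤n) (sym (≤⇒≤ᵇ≡true j≤n))
... | no j≰n = trans (below n (≰⇒> j≰n)) (sym (≰⇒≤ᵇ≡false j≰n))

fin-or-false : (α : ℕ∞) (t : ℕ) → (∃ λ j → α ≈∞ fin j) ⊎ proj₁ α t ≡ false
fin-or-false α zero with proj₁ α 0 in α0
... | false = inj₂ refl
... | true = inj₁ (0 , least⇒≈fin α (α0 , λ _ ()))
fin-or-false α (suc t) with proj₁ α (suc t) in α[1+t]
... | false = inj₂ refl
... | true with fin-or-false α t
...   | inj₁ found = inj₁ found
...   | inj₂ αt = inj₁ (suc t , least⇒≈fin α (α[1+t] , λ i i<1+t → false-downward α αt (≤-pred i<1+t)))

≉fin⇒≈∞ : (α : ℕ∞) → (∀ j → ¬ α ≈∞ fin j) → α ≈∞ ∞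
≉fin⇒≈∞ α α≉fin t with fin-or-false α t
... | inj₁ (j , α≈fin) = contradiction α≈fin (α≉fin j)
... | inj₂ αt = αt

runningOr : (ℕ → Bool) → ℕ → Bool
runningOr γ zero = γ zero
runningOr γ (suc t) = runningOr γ t ∨ γ (suc t)

runningOr∞ : (ℕ → Bool) → ℕ∞
runningOr∞ γ = runningOr γ , λ t → ≤-from-⇒ (cong (_∨ γ (suc t)))

runningOr-self : ∀ γ {t} → γ t ≡ true → runningOr γ t ≡ true
runningOr-self γ {zero} γt = γt
runningOr-self γ {suc t} γt = trans (cong (runningOr γ t ∨_) γt) (∨-zeroʳ _)

runningOr-≥ : ∀ γ {u t} → γ u ≡ true → u ≤ t → runningOr γ t ≡ true
runningOr-≥ γ γu = true-upward (runningOr∞ γ) (runningOr-self γ γu)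

runningOr-witness : ∀ γ t → runningOr γ t ≡ true → ∃ λ u → u ≤ t × γ u ≡ true
runningOr-witness γ zero γ0 = 0 , z≤n , γ0
runningOr-witness γ (suc t) h with runningOr γ t in earlier
... | true = let (u , u≤t , γu) = runningOr-witness γ t earlier in u , m≤n⇒m≤1+n u≤t , γu
... | false = suc t , ≤-refl , h

runningOr-≈ : ∀ γ (α : ℕ∞) → (∀ t → γ t ≡ proj₁ α t) → runningOr∞ γ ≈∞ α
runningOr-≈ γ α γ≈α zero = γ≈α zero
runningOr-≈ γ α γ≈α (suc t) = begin
  runningOr γ t ∨ γ (suc t)      ≡⟨ cong₂ _∨_ (runningOr-≈ γ α γ≈α t) (γ≈α (suc t)) ⟩
  proj₁ α t ∨ proj₁ α (suc t)    ≡⟨ ≤⇒∨≡ (proj₂ α t) ⟩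
  proj₁ α (suc t)                ∎
  where open ≡-Reasoning

runningOr-≈fin : ∀ γ j → runningOr∞ γ ≈∞ fin j → LeastTrue γ j
runningOr-≈fin γ j ≈fin = γj , below
  where
  j≤-of-true : ∀ {i} → γ i ≡ true → j ≤ i
  j≤-of-true {i} γi = ≤ᵇ≡true⇒≤ j i (trans (sym (≈fin i)) (runningOr-self γ γi))

  γj : γ j ≡ true
  γj with runningOr-witness γ j (trans (≈fin j) (≤⇒≤ᵇ≡true (≤-refl {j})))
  ... | u , u≤j , γu with refl ← ≤-antisym u≤j (j≤-of-true γu) = γu

  below : ∀ i → i < j → γ i ≡ false
  below i i<j = ≢true⇒≡false (<⇒≱ i<j ∘ j≤-of-true)

leastTrue : ∀ s {m} → s m ≡ true → ∃ (LeastTrue s)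
leastTrue s {m} sm with fin-or-false (runningOr∞ s) m
... | inj₁ (j , ≈fin) = j , runningOr-≈fin s j ≈fin
... | inj₂ none = contradiction none (≡true⇒≢false (runningOr-self s sm))

-- Escardó's universal witness: the least n with q (fin n) = 1, or ∞.
searchPoint : (ℕ∞ → Bool) → ℕ∞
searchPoint q = runningOr∞ (q ∘ fin)

searchPoint-correct : ∀ q → RespectsEq q → q (searchPoint q) ≡ false → ∀ β → q β ≡ false
searchPoint-correct q q-resp qε≡false β = ≢true⇒≡false λ qβ → ≡true⇒≢false qβ (q-β qβ)
  where
  ε : ℕ∞
  ε = searchPoint q

  ε≈∞ : ε ≈∞ ∞
  ε≈∞ = ≉fin⇒≈∞ ε λ j ε≈fin →
    ≡true⇒≢false (proj₁ (runningOr-≈fin (q ∘ fin) j ε≈fin)) (trans (sym (q-resp ε (fin j) ε≈fin)) qε≡false)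

  q-fin : ∀ j → q (fin j) ≡ false
  q-fin j = ≢true⇒≡false λ qj → ≡true⇒≢false (runningOr-self (q ∘ fin) {j} qj) (ε≈∞ j)

  q-β : q β ≡ true → q β ≡ false
  q-β qβ = begin
    q β  ≡⟨ q-resp β ∞ β≈∞ ⟩
    q ∞  ≡⟨ q-resp ∞ ε (sym ∘ ε≈∞) ⟩
    q ε  ≡⟨ qε≡false ⟩
    false ∎
    where
    open ≡-Reasoning
    β≈∞ : β ≈∞ ∞
    β≈∞ = ≉fin⇒≈∞ β λ j β≈fin → ≡true⇒≢false qβ (trans (q-resp β (fin j) β≈fin) (q-fin j))

ℕ∞-omniscient : ∀ q → RespectsEq q → (∃ λ α → q α ≡ true) ⊎ (∀ α → q α ≡ false)
ℕ∞-omniscient q q-resp with q (searchPoint q) in qε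
... | true = inj₁ (searchPoint q , qε)
... | false = inj₂ (searchPoint-correct q q-resp qε)

pickFirst : ℕ → (ℕ → Bool) → (ℕ → ℕ → Bool) → ℕ → Bool
pickFirst zero s γ t = false
pickFirst (suc n) s γ t = B.if s 0 then γ 0 t else pickFirst n (s ∘ suc) (γ ∘ suc) t

pickFirst-least : ∀ n s γ t {m} → LeastTrue s m → (γ m t ≡ true → m < n) → pickFirst n s γ t ≡ γ m t
pickFirst-least zero s γ t _ bounded = sym (≢true⇒≡false (n≮0 ∘ bounded))
pickFirst-least (suc n) s γ t {zero} (s0 , _) _ rewrite s0 = refl
pickFirst-least (suc n) s γ t {suc m} (sm , below) bounded rewrite below 0 (s≤s z≤n) =
  pickFirst-least n (s ∘ suc) (γ ∘ suc) t (sm , λ i i<m → below (suc i) (s≤s i<m)) (≤-pred ∘ bounded)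

-- At stage t only the indices m < H t need inspecting: for larger m, p m is still 0 there.
glue : (p : ℕ → ℕ∞) (H : ℕ → ℕ) → (ℕ → Bool) → ℕ∞
glue p H s = runningOr∞ λ t → pickFirst (H t) s (proj₁ ∘ p) t

glue-least : ∀ p H → (∀ m t → proj₁ (p m) t ≡ true → m < H t) →
             ∀ s {m} → LeastTrue s m → glue p H s ≈∞ p m
glue-least p H bounded s {m} least =
  runningOr-≈ _ (p m) λ t → pickFirst-least (H t) s (proj₁ ∘ p) t least (bounded m t)

Omniscient : (ℕ → Bool) → Set
Omniscient s = Dec (∃ λ n → s n ≡ true)

_⊑_ : (ℕ → Bool) → (ℕ → Bool) → Set
s ⊑ e = ∀ n → s n ≡ true → e n ≡ true

Cofinal : (ℕ → Bool) → Set
Cofinal e = ∀ K → ∃ λ m → K ≤ m × e m ≡ true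

cofinal-from-successors : ∀ {e} → (∃ λ m → e m ≡ true) →
                          (∀ m → e m ≡ true → ∃ λ m′ → m < m′ × e m′ ≡ true) → Cofinal e
cofinal-from-successors (m , em) next zero = m , z≤n , em
cofinal-from-successors start next (suc K) =
  let (m , K≤m , em) = cofinal-from-successors start next K
      (m′ , m<m′ , em′) = next m em
  in m′ , ≤-trans (s≤s K≤m) m<m′ , em′

module OmniscientBelow (e : ℕ → Bool) (omniscient : ∀ s → s ⊑ e → Omniscient s) where

  LPO-from-cofinal : Cofinal e → LPO
  LPO-from-cofinal cofinal c with omniscient (λ m → e m ∧ runningOr c m) (λ m → ∧-conicalˡ _ _)
  ... | yes (m , h) = let (u , _ , cu) = runningOr-witness c m (∧-conicalʳ _ _ h) in inj₂ (u , cu)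
  ... | no none = inj₁ λ n → ≢true⇒≡false λ cn →
    let (m , n≤m , em) = cofinal n in none (m , cong₂ _∧_ em (runningOr-≥ c cn n≤m))

  trueFrom? : ∀ K → Dec (∃ λ m → K ≤ m × e m ≡ true)
  trueFrom? K = map′ (λ (m , h) → m , ≤ᵇ≡true⇒≤ K m (∧-conicalˡ _ _ h) , ∧-conicalʳ _ _ h)
                     (λ (m , K≤m , em) → m , cong₂ _∧_ (≤⇒≤ᵇ≡true K≤m) em)
                     (omniscient (λ m → (K ≤ᵇ m) ∧ e m) (λ m → ∧-conicalʳ _ _))

  isLastTrue : ℕ → Bool
  isLastTrue m = not (does (trueFrom? (suc m))) ∧ e m

  isLastTrue⇒¬later : ∀ {m} → isLastTrue m ≡ true → ¬ (∃ λ n → suc m ≤ n × e n ≡ true)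
  isLastTrue⇒¬later {m} last later =
    ≡true⇒≢false last (cong (λ b → not b ∧ e m) (dec-true (trueFrom? (suc m)) later))

  ¬later⇒isLastTrue : ∀ {m} → ¬ (∃ λ n → suc m ≤ n × e n ≡ true) → e m ≡ true → isLastTrue m ≡ true
  ¬later⇒isLastTrue {m} none em = cong₂ (λ b c → not b ∧ c) (dec-false (trueFrom? (suc m)) none) em

  eventuallyFalse : ¬ LPO → ∃ λ N → ∀ m → m ≥ N → e m ≡ false
  eventuallyFalse ¬lpo with omniscient isLastTrue (λ m → ∧-conicalʳ _ _)
  ... | yes (m , last) = suc m , λ n n≥1+m → ≢true⇒≡false λ en → isLastTrue⇒¬later last (n , n≥1+m , en)
  ... | no noLast with trueFrom? 0
  ...   | no none = 0 , λ n _ → ≢true⇒≡false λ en → none (n , z≤n , en)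
  ...   | yes (m , _ , em) = contradiction (LPO-from-cofinal (cofinal-from-successors (m , em) next)) ¬lpo
    where
    next : ∀ m → e m ≡ true → ∃ λ m′ → m < m′ × e m′ ≡ true
    next m em with trueFrom? (suc m)
    ... | yes later = later
    ... | no none = contradiction (m , ¬later⇒isLastTrue none em) noLast

prefixMax : (ℕ → ℕ) → ℕ → ℕ
prefixMax g zero = g zero
prefixMax g (suc t) = g (suc t) ⊔ prefixMax g t

≤-prefixMax : ∀ g {j} t → j ≤ t → g j ≤ prefixMax g t
≤-prefixMax g zero z≤n = ≤-refl
≤-prefixMax g (suc t) j≤1+t with m≤n⇒m<n∨m≡n j≤1+t
... | inj₁ j<1+t = ≤-trans (≤-prefixMax g t (≤-pred j<1+t)) (m≤n⊔m (g (suc t)) _)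
... | inj₂ refl = m≤m⊔n _ _

eventuallyZero-bound : ∀ {s} (s→0 : EventuallyZero s) {m} → s m ≡ true → m < proj₁ s→0
eventuallyZero-bound (N , zero-from) {m} sm = ≰⇒> λ N≤m → ≡true⇒≢false sm (zero-from m N≤m)

module PointwiseToZero (f : ℕ → ℕ∞ → Bool) (f-resp : ∀ n → RespectsEq (f n))
                       (f→0 : ∀ x → EventuallyZero (λ n → f n x)) where

  threshold : ℕ → ℕ
  threshold j = proj₁ (f→0 (fin j))

  modulus : ℕ → ℕ
  modulus = prefixMax threshold

  hit⇒<modulus : ∀ m α → f m α ≡ true → ∀ t → proj₁ α t ≡ true → m < modulus t
  hit⇒<modulus m α fα t αt with fin-or-false α t
  ... | inj₂ αt≡false = contradiction αt≡false (≡true⇒≢false αt)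
  ... | inj₁ (j , α≈fin) = <-≤-trans m<threshold (≤-prefixMax threshold t j≤t)
    where
    m<threshold : m < threshold j
    m<threshold = eventuallyZero-bound (f→0 (fin j)) (trans (sym (f-resp m α (fin j) α≈fin)) fα)
    j≤t : j ≤ t
    j≤t = ≤ᵇ≡true⇒≤ j t (trans (sym (α≈fin t)) αt)

  witness : ℕ → ℕ∞
  witness m with ℕ∞-omniscient (f m) (f-resp m)
  ... | inj₁ (α , _) = α
  ... | inj₂ _ = ∞

  hits : ℕ → Bool
  hits m = f m (witness m)

  witness⇒<modulus : ∀ m t → proj₁ (witness m) t ≡ true → m < modulus t
  witness⇒<modulus m t with ℕ∞-omniscient (f m) (f-resp m)
  ... | inj₁ (α , fα) = hit⇒<modulus m α fα t
  ... | inj₂ _ = λ ()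

  no-hit⇒vanishes : ∀ m → hits m ≡ false → ∀ α → f m α ≡ false
  no-hit⇒vanishes m with ℕ∞-omniscient (f m) (f-resp m)
  ... | inj₁ (α , fα) = λ fα≡false → contradiction fα≡false (≡true⇒≢false fα)
  ... | inj₂ vanishes = λ _ → vanishes

  omniscient-⊑hits : ∀ s → s ⊑ hits → Omniscient s
  omniscient-⊑hits s s⊑hits =
    map′ (λ (m , _ , sm) → m , sm)
         (λ (m , sm) → let (m₀ , least) = leastTrue s sm in m₀ , below least , proj₁ least)
         (anyUpTo? (λ m → s m B≟ true) (proj₁ (f→0 x)))
    where
    x : ℕ∞
    x = glue witness modulus s
    below : ∀ {m₀} → LeastTrue s m₀ → m₀ < proj₁ (f→0 x)
    below {m₀} least = eventuallyZero-bound (f→0 x)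
      (trans (f-resp m₀ x (witness m₀) (glue-least witness modulus witness⇒<modulus s least))
             (s⊑hits m₀ (proj₁ least)))

corollary8 : ¬ LPO → (f : ℕ → ℕ∞ → Bool) → (∀ n → RespectsEq (f n))
    → (∀ x → EventuallyZero (λ n → f n x))
    → ∃ λ N → ∀ i → i ≥ N → ∀ α → f i α ≡ false
corollary8 ¬lpo f f-resp f→0 =
  let (N , hits-vanish) = OmniscientBelow.eventuallyFalse hits omniscient-⊑hits ¬lpo
  in N , λ i i≥N → no-hit⇒vanishes i (hits-vanish i i≥N)
  where open PointwiseToZero f f-resp f→0
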